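{- Let $\mathbb{F}$ be a field, let $n\geq 2$, let $y\in\mathbb{F}$ and let $x\in\mathbb{F}^{\times}$ with $x\notin\{1,-1\}$. Then the columns of the matrix $P_1\!\left(\frac{yx}{x^2-1}\right)$ are eigenvectors of $Q(y,x)$.
   Context: All matrices are $n\times n$ with indices $1\le i,j\le n$, and the convention $0^0=1$ is used. For $w\in\mathbb{F}$, $P_1(w)$ is the matrix with $(i,j)$ entry $w^{j-i}\binom{j-1}{i-1}$ if $j\geq i$ and $0$ otherwise. For $y\in\mathbb{F}$, $x\in\mathbb{F}^{\times}$, the Zhang–Liu matrix $Q(y,x)$ has $(i,j)$ entry $y^{j-i}x^{j+i-2}\binom{j-1}{i-1}$ if $j\geq i$ and $0$ otherwise. -}

module Defs where

open import Level using (Level; suc; _⊔_)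
open import Algebra.Bundles using (CommutativeRing; Semiring)
open import Data.Nat using (ℕ; _≤_; _≤ᵇ_)
open import Data.Nat.Combinatorics using (_C_)
open import Data.Fin using (Fin; toℕ)
open import Data.Bool using (if_then_else_)
open import Data.Product using (∃; _×_)
open import Relation.Nullary using (¬_)
import Algebra.Definitions.RawSemiring as RS

-- The inverse is a total operation
-- (its value at 0 is irrelevant), with the law only required for x ≉ 0.
record Field (c ℓ : Level) : Set (suc (c ⊔ ℓ)) where
  field
    commutativeRing : CommutativeRing c ℓ
  open CommutativeRing commutativeRing public
  field
    _⁻¹       : Carrier → Carrier
    0≉1       : ¬ (0# ≈ 1#)
    ⁻¹-inverseʳ : ∀ x → ¬ (x ≈ 0#) → x * (x ⁻¹) ≈ 1#

module FieldDefs {c ℓ : Level} (F : Field c ℓ) where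
  open Field F
  open RS (Semiring.rawSemiring semiring) public using (_^_; sum) renaming (_×_ to _·ℕ_)

  -- n × n matrices and vectors over F, indices 0..n-1
  -- (paper index i corresponds to toℕ i + 1).
  Matrix : ℕ → Set c
  Matrix n = Fin n → Fin n → Carrier

  Vect : ℕ → Set c
  Vect n = Fin n → Carrier

  ι : ℕ → Carrier
  ι k = k ·ℕ 1#

  -- P₁(w)_{ij} = w^{j-i} binom(j-1,i-1) if j ≥ i, else 0  (0^0 = 1 via _^_)
  P₁ : ∀ {n} → Carrier → Matrix n
  P₁ w i j = if toℕ i ≤ᵇ toℕ j
             then w ^ (toℕ j Data.Nat.∸ toℕ i) * ι (toℕ j C toℕ i)
             else 0#

  -- Q(y,x)_{ij} = y^{j-i} x^{j+i-2} binom(j-1,i-1) if j ≥ i, else 0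
  -- (with 0-based indices, j+i-2 becomes toℕ j + toℕ i)
  Q : ∀ {n} → Carrier → Carrier → Matrix n
  Q y x i j = if toℕ i ≤ᵇ toℕ j
              then y ^ (toℕ j Data.Nat.∸ toℕ i) * x ^ (toℕ j Data.Nat.+ toℕ i)
                     * ι (toℕ j C toℕ i)
              else 0#

  _·_ : ∀ {n} → Matrix n → Vect n → Vect n
  (M · v) i = sum (λ j → M i j * v j)

  column : ∀ {n} → Matrix n → Fin n → Vect n
  column M j i = M i j

  IsEigenvector : ∀ {n} → Matrix n → Vect n → Set (c ⊔ ℓ)
  IsEigenvector M v =
    (∃ λ i → ¬ (v i ≈ 0#)) × (∃ λ μ → ∀ i → (M · v) i ≈ μ * v i)

module Submission where

-- The only property of w that matters is the identity
--     y x + w = x² w,                                                  (★)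
-- which holds because w (x² - 1) = y x.  Both matrices are upper
-- triangular; with 0-based indices i ≤ k = i+m ≤ j = i+d the identity
-- C(j,k) C(k,i) = C(j,i) C(d,m) factors the product of entries as
--     Q_{ik} P₁(w)_{kj} = C(j,i) x^{2i} · C(d,m) (yx)^m w^{d-m}.
-- Summing over m with the binomial theorem and then applying (★) gives
--     (Q · P₁(w))_{ij} = C(j,i) x^{2i} (x² w)^d = x^{2j} P₁(w)_{ij},
-- so the j-th column has eigenvalue x^{2j}; it is nonzero because its
-- j-th entry is 1.

open import Defs
open import Level using (Level)
open import Data.Nat using (ℕ; _≤_)
open import Data.Fin using (Fin)
open import Relation.Nullary using (¬_)

open import Algebra.Bundles using (Semiring; CommutativeSemiring)
open import Data.Bool using (true; false; if_then_else_)
open import Data.Empty using (⊥-elim)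
open import Data.Fin using (toℕ)
open import Data.Fin.Properties using (toℕ<n)
open import Data.Nat as N using (zero; suc; _<_; _≤ᵇ_; _≤?_; s≤s)
import Data.Nat.Properties as NP
open import Data.Product using (_,_)
open import Data.Unit using (tt)
open import Relation.Binary.PropositionalEquality as Eq using (_≡_; cong)
open import Relation.Nullary using (yes; no)
import Algebra.Definitions.RawSemiring as RawSemiringDefs

module BinomialCoefficients where
  open import Data.Nat using (_+_; _*_; _∸_; _!; NonZero)
  open import Data.Nat.Combinatorics using (_C_; nCk≡n!/k![n-k]!; k![n∸k]!∣n!)
  open import Data.Nat.DivMod using (m/n*n≡m)
  open import Data.Nat.Solver using (module +-*-Solver)
  open +-*-Solver using (solve; _:*_; _:=_)
  open Eq using (refl; sym; trans; subst)
  open Eq.≡-Reasoning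

  choose-factorials : ∀ a b → ((a + b) C a) * (a ! * b !) ≡ (a + b) !
  choose-factorials a b =
    subst (λ t → ((a + b) C a) * (a ! * t !) ≡ (a + b) !) (NP.m+n∸m≡n a b)
          (trans (cong (_* (a ! * (a + b ∸ a) !)) (nCk≡n!/k![n-k]! a≤a+b))
                 (m/n*n≡m (k![n∸k]!∣n! a≤a+b)))
    where
    a≤a+b : a ≤ a + b
    a≤a+b = NP.m≤m+n a b
    instance _ = NP._!*_!≢0 a (a + b ∸ a)

  -- C(i+m+r, i+m) C(i+m, i) = C(i+m+r, i) C(m+r, m): both count the
  -- ordered splittings of an (i+m+r)-set into blocks of sizes i, m, r.
  choose-twice : ∀ i m r →
    ((i + (m + r)) C (i + m)) * ((i + m) C i) ≡ ((i + (m + r)) C i) * ((m + r) C m)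
  choose-twice i m r =
    NP.*-cancelʳ-≡ _ _ (i ! * (m ! * r !)) {{nonZero}} (trans left (sym right))
    where
    nonZero : NonZero (i ! * (m ! * r !))
    nonZero = NP.m*n≢0 (i !) (m ! * r !) {{NP._!≢0 i}} {{NP._!*_!≢0 m r}}
    left : ((i + (m + r)) C (i + m)) * ((i + m) C i) * (i ! * (m ! * r !)) ≡ (i + (m + r)) !
    left = begin
      ((i + (m + r)) C (i + m)) * ((i + m) C i) * (i ! * (m ! * r !))
        ≡⟨ solve 5 (λ a b x y z → a :* b :* (x :* (y :* z)) := a :* ((b :* (x :* y)) :* z))
                 refl ((i + (m + r)) C (i + m)) ((i + m) C i) (i !) (m !) (r !) ⟩
      ((i + (m + r)) C (i + m)) * ((((i + m) C i) * (i ! * m !)) * r !)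
        ≡⟨ cong (λ t → ((i + (m + r)) C (i + m)) * (t * r !)) (choose-factorials i m) ⟩
      ((i + (m + r)) C (i + m)) * ((i + m) ! * r !)
        ≡⟨ subst (λ t → (t C (i + m)) * ((i + m) ! * r !) ≡ t !) (NP.+-assoc i m r)
                 (choose-factorials (i + m) r) ⟩
      (i + (m + r)) ! ∎
    right : ((i + (m + r)) C i) * ((m + r) C m) * (i ! * (m ! * r !)) ≡ (i + (m + r)) !
    right = begin
      ((i + (m + r)) C i) * ((m + r) C m) * (i ! * (m ! * r !))
        ≡⟨ solve 5 (λ a b x y z → a :* b :* (x :* (y :* z)) := a :* (x :* (b :* (y :* z))))
                 refl ((i + (m + r)) C i) ((m + r) C m) (i !) (m !) (r !) ⟩
      ((i + (m + r)) C i) * (i ! * (((m + r) C m) * (m ! * r !)))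
        ≡⟨ cong (λ t → ((i + (m + r)) C i) * (i ! * t)) (choose-factorials m r) ⟩
      ((i + (m + r)) C i) * (i ! * (m + r) !)
        ≡⟨ choose-factorials i (m + r) ⟩
      (i + (m + r)) ! ∎

module IndexArithmetic where
  open import Data.Nat using (_+_)
  open import Data.Nat.Solver using (module +-*-Solver)
  open +-*-Solver using (solve; _:+_; _:=_; con)

  interchange : ∀ a b → (a + a) + (b + b) ≡ (a + b) + (a + b)
  interchange = solve 2 (λ a b → (a :+ a) :+ (b :+ b) := (a :+ b) :+ (a :+ b)) Eq.refl

  split-window : ∀ i d e → suc (i + d) + e ≡ i + (suc d + e)
  split-window = solve 3 (λ i d e → (con 1 :+ (i :+ d)) :+ e := i :+ ((con 1 :+ d) :+ e)) Eq.refl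

open BinomialCoefficients using (choose-twice)
open IndexArithmetic using (interchange; split-window)

if-≤ᵇ-yes : ∀ {a} {A : Set a} {m n} {u v : A} → m ≤ n → (if m ≤ᵇ n then u else v) ≡ u
if-≤ᵇ-yes {m = m} {n} m≤n with m ≤ᵇ n | NP.≤⇒≤ᵇ m≤n
... | true | _ = Eq.refl

if-≤ᵇ-no : ∀ {a} {A : Set a} {m n} {u v : A} → ¬ m ≤ n → (if m ≤ᵇ n then u else v) ≡ v
if-≤ᵇ-no {m = m} {n} m≰n with m ≤ᵇ n | NP.≤ᵇ⇒≤ m n
... | false | _ = Eq.refl
... | true | m≤n = ⊥-elim (m≰n (m≤n tt))

module InitialSegmentSums {c ℓ} (R : Semiring c ℓ) where
  open Semiring R
  open RawSemiringDefs rawSemiring using (sum)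

  Σ< : ℕ → (ℕ → Carrier) → Carrier
  Σ< zero    f = 0#
  Σ< (suc n) f = f 0 + Σ< n (λ k → f (suc k))

  sum-toℕ : ∀ n (f : ℕ → Carrier) → sum {n} (λ k → f (toℕ k)) ≈ Σ< n f
  sum-toℕ zero    f = refl
  sum-toℕ (suc n) f = +-congˡ (sum-toℕ n (λ k → f (suc k)))

  Σ<-cong : ∀ n {f g : ℕ → Carrier} → (∀ k → k < n → f k ≈ g k) → Σ< n f ≈ Σ< n g
  Σ<-cong zero    f≈g = refl
  Σ<-cong (suc n) f≈g =
    +-cong (f≈g 0 (s≤s N.z≤n)) (Σ<-cong n (λ k k<n → f≈g (suc k) (s≤s k<n)))

  Σ<-vanishing : ∀ n (f : ℕ → Carrier) → (∀ k → k < n → f k ≈ 0#) → Σ< n f ≈ 0#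
  Σ<-vanishing zero    f f≈0 = refl
  Σ<-vanishing (suc n) f f≈0 =
    trans (+-cong (f≈0 0 (s≤s N.z≤n)) (Σ<-vanishing n _ (λ k k<n → f≈0 (suc k) (s≤s k<n))))
          (+-identityˡ 0#)

  Σ<-+ : ∀ p q (f : ℕ → Carrier) → Σ< (p N.+ q) f ≈ Σ< p f + Σ< q (λ k → f (p N.+ k))
  Σ<-+ zero    q f = sym (+-identityˡ _)
  Σ<-+ (suc p) q f = trans (+-congˡ (Σ<-+ p q (λ k → f (suc k)))) (sym (+-assoc _ _ _))

  Σ<-*ˡ : ∀ a n (f : ℕ → Carrier) → a * Σ< n f ≈ Σ< n (λ k → a * f k)
  Σ<-*ˡ a zero    f = zeroʳ a
  Σ<-*ˡ a (suc n) f = trans (distribˡ a _ _) (+-congˡ (Σ<-*ˡ a n (λ k → f (suc k))))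

  -- A family vanishing outside the window [i, i+l) sums to its sum over
  -- the window; this is how triangularity shrinks a matrix product.
  Σ<-window : ∀ i l e (f : ℕ → Carrier) →
    (∀ k → k < i → f k ≈ 0#) → (∀ k → f (i N.+ (l N.+ k)) ≈ 0#) →
    Σ< (i N.+ (l N.+ e)) f ≈ Σ< l (λ m → f (i N.+ m))
  Σ<-window i l e f below above = begin
    Σ< (i N.+ (l N.+ e)) f
      ≈⟨ Σ<-+ i (l N.+ e) f ⟩
    Σ< i f + Σ< (l N.+ e) (λ k → f (i N.+ k))
      ≈⟨ +-cong (Σ<-vanishing i f below) (Σ<-+ l e (λ k → f (i N.+ k))) ⟩
    0# + (Σ< l (λ m → f (i N.+ m)) + Σ< e (λ k → f (i N.+ (l N.+ k))))
      ≈⟨ +-identityˡ _ ⟩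
    Σ< l (λ m → f (i N.+ m)) + Σ< e (λ k → f (i N.+ (l N.+ k)))
      ≈⟨ +-congˡ (Σ<-vanishing e _ (λ k _ → above k)) ⟩
    Σ< l (λ m → f (i N.+ m)) + 0#
      ≈⟨ +-identityʳ _ ⟩
    Σ< l (λ m → f (i N.+ m)) ∎
    where open import Relation.Binary.Reasoning.Setoid setoid

module TriangularProduct {c ℓ} (R : CommutativeSemiring c ℓ) where
  open CommutativeSemiring R
  open RawSemiringDefs (Semiring.rawSemiring semiring) using (_^_) renaming (_×_ to _·ℕ_)
  open InitialSegmentSums semiring
  open import Data.Nat.Combinatorics using (_C_; nCn≡1)
  import Algebra.Properties.Semiring.Mult semiring as Mult
  import Algebra.Properties.Monoid.Mult +-monoid as MonoidMult
  import Algebra.Properties.Semiring.Exp semiring as Exp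
  import Algebra.Properties.CommutativeSemiring.Exp R as CommExp
  import Algebra.Properties.CommutativeSemiring.Binomial R as Binomial
  import Algebra.Solver.Ring.NaturalCoefficients.Default R as Solver
  open Solver using (_:*_; _:=_)
  open import Relation.Binary.Reasoning.Setoid setoid

  ι : ℕ → Carrier
  ι k = k ·ℕ 1#

  ·ℕ-as-ι : ∀ n a → n ·ℕ a ≈ ι n * a
  ·ℕ-as-ι n a = sym (trans (Mult.×-assoc-* n 1# a) (MonoidMult.×-congʳ n (*-identityˡ a)))

  binomial-theorem : ∀ a b d →
    (a + b) ^ d ≈ Σ< (suc d) (λ m → ι (d C m) * (a ^ m * b ^ (d N.∸ m)))
  binomial-theorem a b d =
    trans (Binomial.theorem d a b)
          (trans (sum-toℕ (suc d) (λ m → (d C m) ·ℕ monomial m))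
                 (Σ<-cong (suc d) (λ m _ → ·ℕ-as-ι (d C m) (monomial m))))
    where
    monomial : ℕ → Carrier
    monomial m = a ^ m * b ^ (d N.∸ m)

  module _ (y x w : Carrier) where

    Qℕ : ℕ → ℕ → Carrier
    Qℕ i k = if i ≤ᵇ k then y ^ (k N.∸ i) * x ^ (k N.+ i) * ι (k C i) else 0#

    Pℕ : ℕ → ℕ → Carrier
    Pℕ k j = if k ≤ᵇ j then w ^ (j N.∸ k) * ι (j C k) else 0#

    P-diagonal : ∀ j → Pℕ j j ≈ 1#
    P-diagonal j = begin
      Pℕ j j                   ≡⟨ if-≤ᵇ-yes (NP.≤-refl {j}) ⟩
      w ^ (j N.∸ j) * ι (j C j) ≈⟨ *-cong (Exp.^-congʳ w (NP.n∸n≡0 j))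
                                          (reflexive (cong ι (nCn≡1 j))) ⟩
      1# * ι 1                 ≈⟨ *-identityˡ _ ⟩
      ι 1                      ≈⟨ MonoidMult.×-homo-1 1# ⟩
      1# ∎

    Q-lower : ∀ {i k} → ¬ i ≤ k → Qℕ i k ≈ 0#
    Q-lower i≰k = reflexive (if-≤ᵇ-no i≰k)

    P-lower : ∀ {k j} → ¬ k ≤ j → Pℕ k j ≈ 0#
    P-lower k≰j = reflexive (if-≤ᵇ-no k≰j)

    expansion-term : ℕ → ℕ → Carrier
    expansion-term d m = ι (d C m) * ((y * x) ^ m * w ^ (d N.∸ m))

    entry-product : ∀ i m r →
      Qℕ i (i N.+ m) * Pℕ (i N.+ m) (i N.+ (m N.+ r))
        ≈ (ι ((i N.+ (m N.+ r)) C i) * x ^ (i N.+ i)) * expansion-term (m N.+ r) m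
    entry-product i m r = begin
      Qℕ i (i N.+ m) * Pℕ (i N.+ m) (i N.+ (m N.+ r))
        ≡⟨ Eq.cong₂ _*_ (if-≤ᵇ-yes (NP.m≤m+n i m))
                        (if-≤ᵇ-yes (NP.+-monoʳ-≤ i (NP.m≤m+n m r))) ⟩
      (y ^ ((i N.+ m) N.∸ i) * x ^ ((i N.+ m) N.+ i) * ι B) * (w ^ (j N.∸ (i N.+ m)) * ι A)
        ≈⟨ *-cong (*-congʳ (*-cong (Exp.^-congʳ y (NP.m+n∸m≡n i m)) x-exponent))
                  (*-congʳ (Exp.^-congʳ w (NP.[m+n]∸[m+o]≡n∸o i (m N.+ r) m))) ⟩
      (y ^ m * (x ^ (i N.+ i) * x ^ m) * ι B) * (w ^ (d N.∸ m) * ι A)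
        ≈⟨ Solver.solve 6 (λ Y X2 Xm W a b → (Y :* (X2 :* Xm) :* b) :* (W :* a)
                                            := X2 :* (a :* b) :* (Y :* Xm :* W)) refl
             (y ^ m) (x ^ (i N.+ i)) (x ^ m) (w ^ (d N.∸ m)) (ι A) (ι B) ⟩
      x ^ (i N.+ i) * (ι A * ι B) * (y ^ m * x ^ m * w ^ (d N.∸ m))
        ≈⟨ *-cong (*-congˡ binomial-factor) (*-congʳ (sym (CommExp.^-distrib-* y x m))) ⟩
      x ^ (i N.+ i) * (ι Cj * ι Cd) * ((y * x) ^ m * w ^ (d N.∸ m))
        ≈⟨ Solver.solve 5 (λ X2 a b Y W → X2 :* (a :* b) :* (Y :* W)
                                         := (a :* X2) :* (b :* (Y :* W))) refl
             (x ^ (i N.+ i)) (ι Cj) (ι Cd) ((y * x) ^ m) (w ^ (d N.∸ m)) ⟩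
      (ι Cj * x ^ (i N.+ i)) * (ι Cd * ((y * x) ^ m * w ^ (d N.∸ m))) ∎
      where
      d j A B Cj Cd : ℕ
      d = m N.+ r
      j = i N.+ d
      A = j C (i N.+ m)
      B = (i N.+ m) C i
      Cj = j C i
      Cd = d C m
      x-exponent : x ^ ((i N.+ m) N.+ i) ≈ x ^ (i N.+ i) * x ^ m
      x-exponent = begin
        x ^ ((i N.+ m) N.+ i)     ≡⟨ cong (x ^_) (NP.+-comm (i N.+ m) i) ⟩
        x ^ (i N.+ (i N.+ m))     ≡⟨ cong (x ^_) (NP.+-assoc i i m) ⟨
        x ^ ((i N.+ i) N.+ m)     ≈⟨ Exp.^-homo-* x (i N.+ i) m ⟩
        x ^ (i N.+ i) * x ^ m     ∎
      binomial-factor : ι A * ι B ≈ ι Cj * ι Cd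
      binomial-factor = trans (sym (Mult.×1-homo-* A B))
                              (trans (reflexive (cong ι (choose-twice i m r))) (Mult.×1-homo-* Cj Cd))

    entry-product-≤ : ∀ i d m → m ≤ d →
      Qℕ i (i N.+ m) * Pℕ (i N.+ m) (i N.+ d)
        ≈ (ι ((i N.+ d) C i) * x ^ (i N.+ i)) * expansion-term d m
    entry-product-≤ i d m m≤d with NP.m≤n⇒∃[o]m+o≡n m≤d
    ... | r , Eq.refl = entry-product i m r

    diagonal-block : y * x + w ≈ (x * x) * w → ∀ i d →
      Σ< (suc d) (λ m → Qℕ i (i N.+ m) * Pℕ (i N.+ m) (i N.+ d))
        ≈ x ^ ((i N.+ d) N.+ (i N.+ d)) * Pℕ i (i N.+ d)
    diagonal-block ★ i d = begin
      Σ< (suc d) (λ m → Qℕ i (i N.+ m) * Pℕ (i N.+ m) (i N.+ d))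
        ≈⟨ Σ<-cong (suc d) (λ m m<1+d → entry-product-≤ i d m (NP.≤-pred m<1+d)) ⟩
      Σ< (suc d) (λ m → factor * expansion-term d m)
        ≈⟨ Σ<-*ˡ factor (suc d) (expansion-term d) ⟨
      factor * Σ< (suc d) (expansion-term d)
        ≈⟨ *-congˡ (binomial-theorem (y * x) w d) ⟨
      factor * (y * x + w) ^ d
        ≈⟨ *-congˡ (trans (Exp.^-congˡ d ★) (CommExp.^-distrib-* (x * x) w d)) ⟩
      (ι (j C i) * x ^ (i N.+ i)) * ((x * x) ^ d * w ^ d)
        ≈⟨ Solver.solve 4 (λ c X2 XX W → (c :* X2) :* (XX :* W) := (X2 :* XX) :* (W :* c)) refl
             (ι (j C i)) (x ^ (i N.+ i)) ((x * x) ^ d) (w ^ d) ⟩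
      (x ^ (i N.+ i) * (x * x) ^ d) * (w ^ d * ι (j C i))
        ≈⟨ *-cong x-exponent (*-congʳ (Exp.^-congʳ w (Eq.sym (NP.m+n∸m≡n i d)))) ⟩
      x ^ (j N.+ j) * (w ^ (j N.∸ i) * ι (j C i))
        ≡⟨ cong (x ^ (j N.+ j) *_) (if-≤ᵇ-yes (NP.m≤m+n i d)) ⟨
      x ^ (j N.+ j) * Pℕ i j ∎
      where
      j : ℕ
      j = i N.+ d
      factor : Carrier
      factor = ι (j C i) * x ^ (i N.+ i)
      x-exponent : x ^ (i N.+ i) * (x * x) ^ d ≈ x ^ (j N.+ j)
      x-exponent = begin
        x ^ (i N.+ i) * (x * x) ^ d       ≈⟨ *-congˡ (CommExp.^-distrib-* x x d) ⟩
        x ^ (i N.+ i) * (x ^ d * x ^ d)   ≈⟨ *-congˡ (Exp.^-homo-* x d d) ⟨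
        x ^ (i N.+ i) * x ^ (d N.+ d)     ≈⟨ Exp.^-homo-* x (i N.+ i) (d N.+ d) ⟨
        x ^ ((i N.+ i) N.+ (d N.+ d))     ≡⟨ cong (x ^_) (interchange i d) ⟩
        x ^ (j N.+ j) ∎

    column-eigen : y * x + w ≈ (x * x) * w → ∀ n i j → j < n →
      Σ< n (λ k → Qℕ i k * Pℕ k j) ≈ x ^ (j N.+ j) * Pℕ i j
    -- Below the diagonal every summand and the right-hand side vanish; on or
    -- above it, the sum reduces to the window computed by diagonal-block.
    column-eigen ★ n i j j<n with i ≤? j
    ... | no i≰j =
      trans (Σ<-vanishing n _ vanish) (sym (trans (*-congˡ (P-lower i≰j)) (zeroʳ _)))
      where
      vanish : ∀ k → k < n → Qℕ i k * Pℕ k j ≈ 0#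
      vanish k _ with i ≤? k
      ... | yes i≤k = trans (*-congˡ (P-lower (λ k≤j → i≰j (NP.≤-trans i≤k k≤j)))) (zeroʳ _)
      ... | no i≰k  = trans (*-congʳ (Q-lower i≰k)) (zeroˡ _)
    ... | yes i≤j with NP.m≤n⇒∃[o]m+o≡n i≤j | NP.m≤n⇒∃[o]m+o≡n j<n
    ... | d , Eq.refl | e , Eq.refl = begin
      Σ< (suc (i N.+ d) N.+ e) summand     ≡⟨ cong (λ n → Σ< n summand) (split-window i d e) ⟩
      Σ< (i N.+ (suc d N.+ e)) summand     ≈⟨ Σ<-window i (suc d) e summand below above ⟩
      Σ< (suc d) (λ m → summand (i N.+ m)) ≈⟨ diagonal-block ★ i d ⟩
      x ^ ((i N.+ d) N.+ (i N.+ d)) * Pℕ i (i N.+ d) ∎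
      where
      summand : ℕ → Carrier
      summand k = Qℕ i k * Pℕ k (i N.+ d)
      below : ∀ k → k < i → summand k ≈ 0#
      below k k<i = trans (*-congʳ (Q-lower (NP.<⇒≱ k<i))) (zeroˡ _)
      above : ∀ k → summand (i N.+ (suc d N.+ k)) ≈ 0#
      above k = trans (*-congˡ (P-lower (NP.<⇒≱ j<k))) (zeroʳ _)
        where
        j<k : i N.+ d < i N.+ (suc d N.+ k)
        j<k = NP.+-monoʳ-< i (s≤s (NP.m≤m+n d k))

module FieldFacts {c ℓ} (F : Field c ℓ) where
  open Field F
  open import Algebra.Properties.Group +-group using (inverseˡ-unique; x∙y⁻¹≈ε⇒x≈y)
  open import Algebra.Properties.CommutativeSemigroup *-commutativeSemigroup using (x∙yz≈y∙xz)
  open import Relation.Binary.Reasoning.Setoid setoid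

  -- Constructive form of "x² = 1 implies x = ±1": divide x(x+1) = x+1 by x+1.
  square-root-of-one : ∀ x → x * x ≈ 1# → ¬ (x ≈ - 1#) → x ≈ 1#
  square-root-of-one x x²≈1 x≉-1 = begin
    x               ≈⟨ *-identityʳ x ⟨
    x * 1#          ≈⟨ *-congˡ (⁻¹-inverseʳ v v≉0) ⟨
    x * (v * v ⁻¹)  ≈⟨ *-assoc x v (v ⁻¹) ⟨
    (x * v) * v ⁻¹  ≈⟨ *-congʳ xv≈v ⟩
    v * v ⁻¹        ≈⟨ ⁻¹-inverseʳ v v≉0 ⟩
    1# ∎
    where
    v : Carrier
    v = x + 1#
    v≉0 : ¬ (v ≈ 0#)
    v≉0 v≈0 = x≉-1 (inverseˡ-unique x 1# v≈0)
    xv≈v : x * v ≈ v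
    xv≈v = trans (distribˡ x x 1#) (trans (+-cong x²≈1 (*-identityʳ x)) (+-comm 1# x))

  x²-1≉0 : ∀ x → ¬ (x ≈ 1#) → ¬ (x ≈ - 1#) → ¬ (x * x - 1# ≈ 0#)
  x²-1≉0 x x≉1 x≉-1 x²-1≈0 =
    x≉1 (square-root-of-one x (x∙y⁻¹≈ε⇒x≈y (x * x) 1# x²-1≈0) x≉-1)

  quotient-shift : ∀ a u → ¬ (u ≈ 0#) → a + a * u ⁻¹ ≈ (u + 1#) * (a * u ⁻¹)
  quotient-shift a u u≉0 = begin
    a + a * u ⁻¹                     ≈⟨ +-cong u·a/u≈a (*-identityˡ _) ⟨
    u * (a * u ⁻¹) + 1# * (a * u ⁻¹) ≈⟨ distribʳ (a * u ⁻¹) u 1# ⟨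
    (u + 1#) * (a * u ⁻¹) ∎
    where
    u·a/u≈a : u * (a * u ⁻¹) ≈ a
    u·a/u≈a = begin
      u * (a * u ⁻¹) ≈⟨ x∙yz≈y∙xz u a (u ⁻¹) ⟩
      a * (u * u ⁻¹) ≈⟨ *-congˡ (⁻¹-inverseʳ u u≉0) ⟩
      a * 1#         ≈⟨ *-identityʳ a ⟩
      a              ∎

  eigen-condition : ∀ y x → ¬ (x ≈ 1#) → ¬ (x ≈ - 1#) →
    y * x + (y * x) * (x * x - 1#) ⁻¹ ≈ (x * x) * ((y * x) * (x * x - 1#) ⁻¹)
  eigen-condition y x x≉1 x≉-1 =
    trans (quotient-shift (y * x) (x * x - 1#) (x²-1≉0 x x≉1 x≉-1)) (*-congʳ x²-1+1≈x²)
    where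
    x²-1+1≈x² : (x * x - 1#) + 1# ≈ x * x
    x²-1+1≈x² = trans (+-assoc _ _ _) (trans (+-congˡ (-‿inverseˡ 1#)) (+-identityʳ _))

module Eigenvectors {c ℓ} (F : Field c ℓ) where
  open Field F
  open FieldDefs F
  open InitialSegmentSums semiring using (sum-toℕ)
  open TriangularProduct commutativeSemiring using (Qℕ; Pℕ; P-diagonal; column-eigen)

  P₁-columns-are-eigenvectors : ∀ {n} (y x w : Carrier) → y * x + w ≈ (x * x) * w →
    (j : Fin n) → IsEigenvector (Q {n} y x) (column (P₁ {n} w) j)
  P₁-columns-are-eigenvectors {n} y x w ★ j =
    (j , λ Pjj≈0 → 0≉1 (trans (sym Pjj≈0) (P-diagonal y x w (toℕ j)))) ,
    (x ^ (toℕ j N.+ toℕ j) , λ i →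
       trans (sum-toℕ n (λ k → Qℕ y x w (toℕ i) k * Pℕ y x w k (toℕ j)))
             (column-eigen y x w ★ n (toℕ i) (toℕ j) (toℕ<n j)))

corollary2 : ∀ {c ℓ : Level} (F : Field c ℓ) → let open Field F in let open FieldDefs F in
    (n : ℕ) → 2 ≤ n → (y x : Carrier) → ¬ (x ≈ 0#) → ¬ (x ≈ 1#) → ¬ (x ≈ - 1#) →
    (j : Fin n) →
    IsEigenvector (Q {n} y x) (column (P₁ {n} ((y * x) * ((x * x - 1#) ⁻¹))) j)
corollary2 F n _ y x _ x≉1 x≉-1 =
  Eigenvectors.P₁-columns-are-eigenvectors F y x _ (FieldFacts.eigen-condition F y x x≉1 x≉-1)
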